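{- Let $\mathcal{B}_{b,t}$ be a blossom with base $b$ and tenacity $t<l_m$, and let $v$ be a vertex satisfying $\mathrm{base}^k(v)=b$ for some $k\ge1$. If $t\ge t(\mathrm{base}^{k-1}(v))$ then $v\in\mathcal{B}_{b,t}$.
   Context: $G=(V,E)$ is a finite undirected graph with a matching $M$, with at least one unmatched vertex. Alternating paths are simple paths alternating between unmatched edges (not in $M$) and matched edges (in $M$), starting with an unmatched edge when starting at an unmatched vertex. $l_m$ is the minimum length of an augmenting path (alternating path between two distinct unmatched vertices), $\infty$ if none. $\mathrm{evenlevel}(v)$, $\mathrm{oddlevel}(v)$ are the minimum lengths of even, resp. odd, alternating paths from an unmatched vertex to $v$ ($\infty$ if none); such minimum paths are $\mathrm{evenlevel}(v)$, $\mathrm{oddlevel}(v)$ paths. Tenacity $t(v)=\mathrm{evenlevel}(v)+\mathrm{oddlevel}(v)$. A vertex is outer if $\mathrm{evenlevel}(v)<\mathrm{oddlevel}(v)$. For $t(v)=t<l_m$, $\mathrm{base}(v)$ is the vertex of tenacity $>t$ furthest from the starting unmatched vertex along any $\mathrm{evenlevel}(v)$ or $\mathrm{oddlevel}(v)$ path (known to be independent of the path). Iterated bases: $\mathrm{base}^0(v)=v$, $\mathrm{base}^1(v)=\mathrm{base}(v)$, $\mathrm{base}^{k+1}(v)=\mathrm{base}(\mathrm{base}^k(v))$ whenever $t(\mathrm{base}^k(v))<l_m$. Blossoms: for an outer vertex $b$ and an odd number $t$ with $t<t(b)$ and $t<l_m$, $\mathcal{B}_{b,1}=\emptyset$, and for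 $t\ge3$, with $S_{b,t}=\{v: t(v)=t,\ \mathrm{base}(v)=b\}$, $\mathcal{B}_{b,t}=S_{b,t}\cup\bigcup_{v\in S_{b,t}\cup\{b\},\ v\text{ outer}}\mathcal{B}_{v,t-2}$; $b$ is its base and $t$ its tenacity. -}

module Defs where

open import Data.Nat using (ℕ; zero; suc; _+_; _≤_; _<_; _%_)
open import Data.Fin using (Fin)
open import Data.Bool using (Bool; true; false; not)
open import Data.List using (List; []; _∷_; _++_; length)
open import Data.List.Relation.Unary.All using (All)
open import Data.List.Relation.Unary.Unique.Propositional using (Unique)
open import Data.Product using (Σ; ∃; _×_)
open import Data.Sum using (_⊎_)
open import Relation.Nullary using (¬_)
open import Relation.Binary.PropositionalEquality using (_≡_; _≢_)
open import Relation.Binary.Definitions using (Decidable)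

Even : ℕ → Set
Even n = n % 2 ≡ 0

Odd : ℕ → Set
Odd n = n % 2 ≡ 1

data ℕ∞ : Set where
  fin : ℕ → ℕ∞
  ∞   : ℕ∞

infixl 6 _+∞_
_+∞_ : ℕ∞ → ℕ∞ → ℕ∞
fin m +∞ fin n = fin (m + n)
fin _ +∞ ∞     = ∞
∞     +∞ _     = ∞

infix 4 _<∞_ _≤∞_
data _<∞_ : ℕ∞ → ℕ∞ → Set where
  fin<fin : ∀ {m n} → m < n → fin m <∞ fin n
  fin<∞   : ∀ {m} → fin m <∞ ∞

data _≤∞_ : ℕ∞ → ℕ∞ → Set where
  fin≤fin : ∀ {m n} → m ≤ n → fin m ≤∞ fin n
  _≤∞∞    : ∀ x → x ≤∞ ∞

record Graph (n : ℕ) : Set₁ where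
  field
    Adj        : Fin n → Fin n → Set
    adj?       : Decidable Adj
    adj-sym    : ∀ {u v} → Adj u v → Adj v u
    adj-irrefl : ∀ {u} → ¬ Adj u u

record Matching {n : ℕ} (G : Graph n) : Set₁ where
  open Graph G
  field
    Mt      : Fin n → Fin n → Set
    Mt?     : Decidable Mt
    Mt-sym  : ∀ {u v} → Mt u v → Mt v u
    Mt⊆Adj  : ∀ {u v} → Mt u v → Adj u v
    Mt-func : ∀ {u v w} → Mt u v → Mt u w → v ≡ w

module Theory {n : ℕ} (G : Graph n) (M : Matching G) where
  open Graph G
  open Matching M

  V : Set
  V = Fin n

  Unmatched : V → Set
  Unmatched v = ∀ u → ¬ Mt v u

  EdgeKind : Bool → V → V → Set
  EdgeKind true  u w = Mt u w
  EdgeKind false u w = ¬ Mt u w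

  data AltWalk : Bool → V → V → List V → Set where
    stop : ∀ {b} x → AltWalk b x x (x ∷ [])
    step : ∀ {b x y z ps} → Adj x y → EdgeKind b x y →
           AltWalk (not b) y z ps → AltWalk b x z (x ∷ ps)

  AltPath : V → List V → V → ℕ → Set
  AltPath s ps v ℓ =
    Unmatched s × AltWalk false s v ps × Unique ps × length ps ≡ suc ℓ

  AltPathTo : V → ℕ → Set
  AltPathTo v ℓ = Σ V λ s → Σ (List V) λ ps → AltPath s ps v ℓ

  Augmenting : ℕ → Set
  Augmenting ℓ = Σ V λ s → Σ V λ w → Σ (List V) λ ps →
                 AltPath s ps w ℓ × Unmatched w × s ≢ w

  IsMin : (ℕ → Set) → ℕ∞ → Set
  IsMin P (fin d) = P d × (∀ ℓ → P ℓ → d ≤ ℓ)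
  IsMin P ∞       = ∀ ℓ → ¬ P ℓ

  IsEvenlevel : (V → ℕ∞) → Set
  IsEvenlevel el = ∀ v → IsMin (λ ℓ → Even ℓ × AltPathTo v ℓ) (el v)

  IsOddlevel : (V → ℕ∞) → Set
  IsOddlevel ol = ∀ v → IsMin (λ ℓ → Odd ℓ × AltPathTo v ℓ) (ol v)

  IsLm : ℕ∞ → Set
  IsLm lm = IsMin Augmenting lm

  module Levels (el ol : V → ℕ∞) (lm : ℕ∞) where

    tenacity : V → ℕ∞
    tenacity v = el v +∞ ol v

    Outer : V → Set
    Outer v = el v <∞ ol v

    LevelPath : V → List V → V → Set
    LevelPath s ps v = Σ ℕ λ ℓ → (el v ≡ fin ℓ ⊎ ol v ≡ fin ℓ) × AltPath s ps v ℓ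

    -- IsBase v b : b = base(v), i.e. along every evenlevel(v) or
    -- oddlevel(v) path, b is the vertex of tenacity > t(v) furthest from
    -- the starting unmatched vertex.  (Used only when t(v) < l_m.)
    IsBase : V → V → Set
    IsBase v b = ∀ s ps → LevelPath s ps v →
                 Σ (List V) λ pre → Σ (List V) λ post →
                   ps ≡ pre ++ (b ∷ post) ×
                   tenacity v <∞ tenacity b ×
                   All (λ w → tenacity w ≤∞ tenacity v) post

    data BaseIter : ℕ → V → V → Set where
      base0   : ∀ {v} → BaseIter zero v v
      baseSuc : ∀ {k v u w} → BaseIter k v u → tenacity u <∞ lm →
                IsBase u w → BaseIter (suc k) v w

    -- InBlossom b t w : w ∈ 𝓑_{b,t}.
    -- 𝓑_{b,1} = ∅ (no constructor produces index 1), and for t ≥ 3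
    -- (written 2 + t'), 𝓑_{b,t} = S_{b,t} ∪ ⋃ { 𝓑_{u,t-2} : u ∈ S_{b,t} ∪ {b}, u outer }
    -- with S_{b,t} = { w : t(w) = t, base(w) = b }.
    data InBlossom : V → ℕ → V → Set where
      inS   : ∀ {b t' w} → tenacity w ≡ fin (2 + t') → IsBase w b →
              InBlossom b (2 + t') w
      inSub : ∀ {b t' u w} →
              (u ≡ b ⊎ (tenacity u ≡ fin (2 + t') × IsBase u b)) →
              Outer u → InBlossom u t' w → InBlossom b (2 + t') w

-- The key fact is that the base u of a vertex w of finite tenacity is outer.  On an evenlevel(w) path, u is
-- reached at even distance i: otherwise the matched edge leaving u leads to its mate beyond u, of tenacity
-- at most t(w) < t(u), whereas a vertex's tenacity is at most its mate's.  So evenlevel(u) ≤ i.  If also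
-- oddlevel(u) ≤ evenlevel(u), follow an oddlevel(w) path to its first vertex on the part of the evenlevel(w)
-- path after u and continue along that part forwards to w or backwards to u: the result is an even path to w
-- or an odd path to u, and t(w) < t(u) makes it shorter than evenlevel(w), resp. oddlevel(u).
-- Tenacities are odd and increase strictly along bases, so by induction on k,
-- v ∈ 𝓑_{base^j(v), t(base^{j-1}(v))} for j = 1, …, k, using that 𝓑_{b,t} grows with t when b is outer.

module Submission where

open import Defs
open import Data.Bool using (Bool; true; false; not; _xor_)
import Data.Bool as Bool
open import Data.Bool.Properties using (xor-identityʳ; not-distribˡ-xor; not-distribʳ-xor; ¬-not)
open import Data.Empty using (⊥; ⊥-elim)
open import Data.Fin using (Fin)
import Data.Fin as Fin
open import Data.List using (List; []; _∷_; _++_; _∷ʳ_; [_]; length; reverse)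
open import Data.List.Properties
  using (length-++; length-reverse; reverse-++; unfold-reverse; ∷ʳ-++; ∷-injective)
open import Data.List.Membership.Propositional using (_∈_; _∉_)
open import Data.List.Membership.Propositional.Properties using (∈-++⁺ˡ; ∈-++⁺ʳ; ∈-∃++)
import Data.List.Membership.DecPropositional as DecMembership
open import Data.List.Relation.Unary.All as All using (All; []; _∷_)
import Data.List.Relation.Unary.All.Properties as All
open import Data.List.Relation.Unary.Any using (here; there)
import Data.List.Relation.Unary.Any.Properties as Any
open import Data.List.Relation.Unary.AllPairs using ([]; _∷_)
open import Data.List.Relation.Unary.First as First using (FirstView; first)
open import Data.List.Relation.Unary.First.Properties using (toView)
open import Data.List.Relation.Unary.Unique.Propositional using (Unique)
open import Data.List.Relation.Unary.Unique.Propositional.Properties using (++⁺)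
import Data.List.Relation.Binary.Permutation.Setoid as Permutation
import Data.List.Relation.Binary.Permutation.Setoid.Properties as PermutationProperties
open import Data.Nat using (ℕ; zero; suc; _+_; _%_; _≤_; _<_; z≤n; s≤s; _≤?_; _<?_)
open import Data.Nat.Properties
open import Data.Nat.DivMod using (%-distribˡ-+)
open import Data.Product using (∃; ∃₂; _×_; _,_; proj₁; proj₂)
open import Data.Sum using (_⊎_; inj₁; inj₂)
import Data.Sum as Sum
open import Relation.Binary.Definitions using (DecidableEquality)
open import Relation.Nullary using (¬_; Dec; yes; no)
open import Relation.Nullary.Decidable using (toSum)
open import Relation.Binary.PropositionalEquality
  using (_≡_; refl; sym; trans; cong; cong₂; subst; subst₂; setoid; module ≡-Reasoning)

parity : ℕ → Bool
parity zero          = false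
parity (suc zero)    = true
parity (suc (suc n)) = parity n

parity-suc : ∀ n → parity (suc n) ≡ not (parity n)
parity-suc zero          = refl
parity-suc (suc zero)    = refl
parity-suc (suc (suc n)) = parity-suc n

Even⇒parity≡false : ∀ n → Even n → parity n ≡ false
Even⇒parity≡false zero          _  = refl
Even⇒parity≡false (suc (suc n)) en = Even⇒parity≡false n en

Odd⇒parity≡true : ∀ n → Odd n → parity n ≡ true
Odd⇒parity≡true (suc zero)    _  = refl
Odd⇒parity≡true (suc (suc n)) on = Odd⇒parity≡true n on

parity≡false⇒Even : ∀ n → parity n ≡ false → Even n
parity≡false⇒Even zero          _ = refl
parity≡false⇒Even (suc (suc n)) p = parity≡false⇒Even n p

parity≡true⇒Odd : ∀ n → parity n ≡ true → Odd n
parity≡true⇒Odd (suc zero)    _ = refl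
parity≡true⇒Odd (suc (suc n)) p = parity≡true⇒Odd n p

Odd⇒¬Odd-suc : ∀ n → Odd n → ¬ Odd (suc n)
Odd⇒¬Odd-suc (suc zero)    _  ()
Odd⇒¬Odd-suc (suc (suc n)) on on′ = Odd⇒¬Odd-suc n on on′

Even+Odd⇒Odd : ∀ m n → Even m → Odd n → Odd (m + n)
Even+Odd⇒Odd m n em on = begin
  (m + n) % 2             ≡⟨ %-distribˡ-+ m n 2 ⟩
  (m % 2 + n % 2) % 2     ≡⟨ cong₂ (λ a b → (a + b) % 2) em on ⟩
  1                       ∎
  where open ≡-Reasoning

odd-gap : ∀ {m n} → Odd m → Odd n → m < n → 2 + m ≤ n
odd-gap {m} om on m<n with m≤n⇒m<n∨m≡n m<n
... | inj₁ 1+m<n = 1+m<n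
... | inj₂ refl  = ⊥-elim (Odd⇒¬Odd-suc m om on)

fin≤fin⁻¹ : ∀ {m n} → fin m ≤∞ fin n → m ≤ n
fin≤fin⁻¹ (fin≤fin m≤n) = m≤n

fin<fin⁻¹ : ∀ {m n} → fin m <∞ fin n → m < n
fin<fin⁻¹ (fin<fin m<n) = m<n

<∞-irrefl : ∀ {a} → ¬ a <∞ a
<∞-irrefl (fin<fin m<m) = <-irrefl refl m<m

≤∞-trans : ∀ {a b c} → a ≤∞ b → b ≤∞ c → a ≤∞ c
≤∞-trans (fin≤fin m≤n) (fin≤fin n≤o) = fin≤fin (≤-trans m≤n n≤o)
≤∞-trans a≤b            (_ ≤∞∞)        = _ ≤∞∞

<∞-≤∞-trans : ∀ {a b c} → a <∞ b → b ≤∞ c → a <∞ c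
<∞-≤∞-trans (fin<fin m<n) (fin≤fin n≤o) = fin<fin (<-≤-trans m<n n≤o)
<∞-≤∞-trans (fin<fin _)   (_ ≤∞∞)        = fin<∞
<∞-≤∞-trans fin<∞         (_ ≤∞∞)        = fin<∞

<∞⇒≱∞ : ∀ {a b} → a <∞ b → ¬ b ≤∞ a
<∞⇒≱∞ a<b b≤a = <∞-irrefl (<∞-≤∞-trans a<b b≤a)

<∞-fin : ∀ {a b} → a <∞ b → ∃ λ m → a ≡ fin m
<∞-fin (fin<fin _) = _ , refl
<∞-fin fin<∞       = _ , refl

≤∞fin⇒fin : ∀ {a n} → a ≤∞ fin n → ∃ λ m → a ≡ fin m × m ≤ n
≤∞fin⇒fin (fin≤fin m≤n) = _ , refl , m≤n

+∞≡fin : ∀ a b {m} → a +∞ b ≡ fin m → ∃₂ λ k l → a ≡ fin k × b ≡ fin l × k + l ≡ m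
+∞≡fin (fin k) (fin l) refl = k , l , refl , refl , refl

+∞-mono-≤∞ : ∀ {a b m n} → a ≤∞ fin m → b ≤∞ fin n → a +∞ b ≤∞ fin (m + n)
+∞-mono-≤∞ (fin≤fin k≤m) (fin≤fin l≤n) = fin≤fin (+-mono-≤ k≤m l≤n)

module _ {A : Set} where

  length-++-∷ : ∀ (xs : List A) {x} ys → length (xs ++ x ∷ ys) ≡ suc (length xs + length ys)
  length-++-∷ xs ys = trans (length-++ xs) (+-suc (length xs) (length ys))

  length-∷ʳ : ∀ (xs : List A) {x} → length (xs ∷ʳ x) ≡ suc (length xs)
  length-∷ʳ xs = trans (length-++-∷ xs []) (cong suc (+-identityʳ _))

  length-prefix≤ : ∀ (xs : List A) {x} ys {m} → length (xs ++ x ∷ ys) ≡ suc m → length xs ≤ m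
  length-prefix≤ xs ys eq =
    subst (length xs ≤_) (suc-injective (trans (sym (length-++-∷ xs ys)) eq)) (m≤m+n _ _)

  length-suffix≤ : ∀ (xs : List A) {x} ys {m} → length (xs ++ x ∷ ys) ≡ suc m → length ys ≤ m
  length-suffix≤ xs ys eq =
    subst (length ys ≤_) (suc-injective (trans (sym (length-++-∷ xs ys)) eq)) (m≤n+m _ _)

  Unique-++⁻ˡ : ∀ (xs : List A) {ys} → Unique (xs ++ ys) → Unique xs
  Unique-++⁻ˡ []       _          = []
  Unique-++⁻ˡ (x ∷ xs) (x∉ ∷ uq) = All.++⁻ˡ xs x∉ ∷ Unique-++⁻ˡ xs uq

  Unique-++⁻ʳ : ∀ (xs : List A) {ys} → Unique (xs ++ ys) → Unique ys
  Unique-++⁻ʳ []       uq       = uq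
  Unique-++⁻ʳ (x ∷ xs) (_ ∷ uq) = Unique-++⁻ʳ xs uq

  Unique-∷ʳ-prefix : ∀ (xs : List A) {y ys} → Unique (xs ++ y ∷ ys) → Unique (xs ∷ʳ y)
  Unique-∷ʳ-prefix xs {y} {ys} uq = Unique-++⁻ˡ (xs ∷ʳ y) (subst Unique (sym (∷ʳ-++ xs y ys)) uq)

  Unique-reverse : ∀ {xs : List A} → Unique xs → Unique (reverse xs)
  Unique-reverse {xs} = Unique-resp-↭ (↭-sym (↭-reverse xs))
    where
      open Permutation (setoid A) using (↭-sym)
      open PermutationProperties (setoid A) using (↭-reverse; Unique-resp-↭)

  singleton-split : ∀ {v b : A} pre post → [ v ] ≡ pre ++ b ∷ post → b ≡ v
  singleton-split []          _ refl = refl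
  singleton-split (_ ∷ [])    _ ()
  singleton-split (_ ∷ _ ∷ _) _ ()

  ++-∷-trichotomy : ∀ pre pre′ {b b′ : A} {post post′} →
                    pre ++ b ∷ post ≡ pre′ ++ b′ ∷ post′ →
                    b ≡ b′ ⊎ b ∈ post′ ⊎ b′ ∈ post
  ++-∷-trichotomy []        []         eq = inj₁ (proj₁ (∷-injective eq))
  ++-∷-trichotomy []        (_ ∷ pre′) refl = inj₂ (inj₂ (∈-++⁺ʳ pre′ (here refl)))
  ++-∷-trichotomy (_ ∷ pre) []         refl = inj₂ (inj₁ (∈-++⁺ʳ pre (here refl)))
  ++-∷-trichotomy (_ ∷ pre) (_ ∷ pre′) eq = ++-∷-trichotomy pre pre′ (proj₂ (∷-injective eq))

  first-in : DecidableEquality A → ∀ S {zs} {y : A} → y ∈ zs → y ∈ S → FirstView (_∉ S) (_∈ S) zs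
  first-in _≟_ S {zs} y∈zs y∈S with first (λ z → Sum.swap (toSum (z ∈? S))) zs
    where open DecMembership _≟_ using (_∈?_)
  ... | inj₁ found   = toView found
  ... | inj₂ outside = ⊥-elim (All.lookup outside y∈zs y∈S)

module AlternatingWalks {n : ℕ} (G : Graph n) (M : Matching G) where
  open Graph G
  open Matching M
  open Theory G M

  -- An AltWalk that also records the kind e that an edge extending it past its last vertex must have.
  data Walk : Bool → V → V → List V → Bool → Set where
    stop : ∀ {b} x → Walk b x x [ x ] b
    step : ∀ {b x y z ps e} → Adj x y → EdgeKind b x y → Walk (not b) y z ps e →
           Walk b x z (x ∷ ps) e

  AltWalk⇒Walk : ∀ {b x y ps} → AltWalk b x y ps → ∃ (Walk b x y ps)
  AltWalk⇒Walk (stop x) = _ , stop x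
  AltWalk⇒Walk (step a k w) with AltWalk⇒Walk w
  ... | _ , w′ = _ , step a k w′

  Walk⇒AltWalk : ∀ {b x y ps e} → Walk b x y ps e → AltWalk b x y ps
  Walk⇒AltWalk (stop x)     = stop x
  Walk⇒AltWalk (step a k w) = step a k (Walk⇒AltWalk w)

  Walk-length : ∀ {b x y ps e} → Walk b x y ps e → ∃ λ ℓ → length ps ≡ suc ℓ
  Walk-length (stop _)     = _ , refl
  Walk-length (step _ _ w) with Walk-length w
  ... | _ , eq = _ , cong suc eq

  Walk-kind : ∀ {b x y ps e ℓ} → Walk b x y ps e → length ps ≡ suc ℓ → e ≡ b xor parity ℓ
  Walk-kind {b} (stop _) refl = sym (xor-identityʳ b)
  Walk-kind {b} {e = e} (step _ _ w) refl with Walk-length w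
  ... | ℓ , eq rewrite eq = begin
    e                          ≡⟨ Walk-kind w eq ⟩
    not b xor parity ℓ         ≡⟨ sym (not-distribˡ-xor b (parity ℓ)) ⟩
    not (b xor parity ℓ)       ≡⟨ not-distribʳ-xor b (parity ℓ) ⟩
    b xor not (parity ℓ)       ≡⟨ cong (b xor_) (sym (parity-suc ℓ)) ⟩
    b xor parity (suc ℓ)       ∎
    where open ≡-Reasoning

  ∈-first : ∀ {b x y ps e} → Walk b x y ps e → x ∈ ps
  ∈-first (stop _)     = here refl
  ∈-first (step _ _ _) = here refl

  ∈-last : ∀ {b x y ps e} → Walk b x y ps e → y ∈ ps
  ∈-last (stop _)     = here refl
  ∈-last (step _ _ w) = there (∈-last w)

  closed-Walk-kind : ∀ {b x ps e} → Walk b x x ps e → Unique ps → e ≡ b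
  closed-Walk-kind (stop _)     _          = refl
  closed-Walk-kind (step _ _ w) (x∉ ∷ _) = ⊥-elim (All.lookup x∉ (∈-last w) refl)

  Walk-split : ∀ pre {b x z y post e} → Walk b x z (pre ++ y ∷ post) e →
               ∃ λ c → Walk b x y (pre ∷ʳ y) c × Walk c y z (y ∷ post) e
  Walk-split []            (stop _)     = _ , stop _ , stop _
  Walk-split []            (step a k w) = _ , stop _ , step a k w
  Walk-split (_ ∷ [])      (step a k w) with Walk-split [] w
  ... | c , w₁ , w₂ = c , step a k w₁ , w₂
  Walk-split (_ ∷ q ∷ pre) (step a k w) with Walk-split (q ∷ pre) w
  ... | c , w₁ , w₂ = c , step a k w₁ , w₂

  Walk-join : ∀ pre {b x y z post c e} → Walk b x y (pre ∷ʳ y) c → Walk c y z (y ∷ post) e →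
              Walk b x z (pre ++ y ∷ post) e
  Walk-join []            (stop _)      w₂ = w₂
  Walk-join (_ ∷ [])      (step a k w₁) w₂ = step a k (Walk-join [] w₁ w₂)
  Walk-join (_ ∷ q ∷ pre) (step a k w₁) w₂ = step a k (Walk-join (q ∷ pre) w₁ w₂)

  Walk-∷ʳ : ∀ {b x y z ps e} → Walk b x y ps e → Adj y z → EdgeKind e y z →
            Walk b x z (ps ∷ʳ z) (not e)
  Walk-∷ʳ (stop _)       a k = step a k (stop _)
  Walk-∷ʳ (step a′ k′ w) a k = step a′ k′ (Walk-∷ʳ w a k)

  Walk-reverse : ∀ {b x y ps e} → Walk b x y ps e → Walk (not e) y x (reverse ps) (not b)
  Walk-reverse (stop x) = stop x
  Walk-reverse {true} {x} (step {ps = ps} a k w) =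
    subst (λ qs → Walk _ _ x qs false) (sym (unfold-reverse x ps))
          (Walk-∷ʳ (Walk-reverse w) (adj-sym a) (Mt-sym k))
  Walk-reverse {false} {x} (step {ps = ps} a k w) =
    subst (λ qs → Walk _ _ x qs true) (sym (unfold-reverse x ps))
          (Walk-∷ʳ (Walk-reverse w) (adj-sym a) (λ m → k (Mt-sym m)))

  record Path (v : V) (e : Bool) (ℓ : ℕ) : Set where
    constructor path
    field
      {source}   : V
      {vertices} : List V
      unmatched  : Unmatched source
      walk       : Walk false source v vertices e
      unique     : Unique vertices
      length≡    : length vertices ≡ suc ℓ

  Path-kind : ∀ {v e ℓ} → Path v e ℓ → e ≡ parity ℓ
  Path-kind (path _ w _ len) = Walk-kind w len

  Path⇒Even : ∀ {v ℓ} → Path v false ℓ → Even ℓ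
  Path⇒Even {ℓ = ℓ} p = parity≡false⇒Even ℓ (sym (Path-kind p))

  Path⇒Odd : ∀ {v ℓ} → Path v true ℓ → Odd ℓ
  Path⇒Odd {ℓ = ℓ} p = parity≡true⇒Odd ℓ (sym (Path-kind p))

  Path⇒AltPathTo : ∀ {v e ℓ} → Path v e ℓ → AltPathTo v ℓ
  Path⇒AltPathTo (path un w uq len) = _ , _ , un , Walk⇒AltWalk w , uq , len

  Shortcut : V → Bool → V → ℕ → Set
  Shortcut w e u n = (∃ λ ℓ → ℓ ≤ n × Path w e ℓ) ⊎ (∃ λ ℓ → ℓ ≤ n × Path u true ℓ)

  splice : ∀ {w u e′ e L′ sl d} → Path w e′ L′ → Walk false u w sl e → Unique sl →
           length sl ≡ suc d → Shortcut w e u (L′ + d)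
  splice {w} {u} {e = e} {L′} {sl} {d} (path un Z uqZ lenZ) S uqS lenS
    with first-in Fin._≟_ sl (∈-last Z) (∈-last S)
  ... | First._++_∷_ {zpre} {x} outside x∈sl zpost with ∈-∃++ x∈sl
  ... | spre , spost , refl with Walk-split zpre Z | Walk-split spre S
  ... | ν , Z₁ , _ | c , S₁ , S₂ = reroute (ν Bool.≟ c)
    where
      zpre≤ : length zpre ≤ L′
      zpre≤ = length-prefix≤ zpre zpost lenZ

      disjoint : ∀ {ys} → (∀ {z} → z ∈ ys → z ∈ sl) → ∀ {z} → ¬ (z ∈ zpre × z ∈ ys)
      disjoint ys⊆sl (z∈zpre , z∈ys) = All.lookup outside z∈zpre (ys⊆sl z∈ys)

      back : Walk (not c) x u (x ∷ reverse spre) true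
      back = subst (λ qs → Walk (not c) x u qs true) (reverse-++ spre [ x ]) (Walk-reverse S₁)

      back⊆sl : ∀ {z} → z ∈ x ∷ reverse spre → z ∈ sl
      back⊆sl (here refl) = ∈-++⁺ʳ spre (here refl)
      back⊆sl (there z∈)  = ∈-++⁺ˡ {ys = x ∷ spost} (Any.reverse⁻ z∈)

      reroute : Dec (ν ≡ c) → Shortcut w e u (L′ + d)
      reroute (yes refl) = inj₁ (_ , +-mono-≤ zpre≤ (length-suffix≤ spre spost lenS) ,
        path un (Walk-join zpre Z₁ S₂)
                (++⁺ (Unique-++⁻ˡ zpre uqZ) (Unique-++⁻ʳ spre uqS) (disjoint (∈-++⁺ʳ spre)))
                (length-++-∷ zpre spost))
      reroute (no ν≢c) = inj₂ (_ , +-mono-≤ zpre≤ spre≤ ,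
        path un (Walk-join zpre (subst (Walk false _ x (zpre ∷ʳ x)) (¬-not ν≢c) Z₁) back)
                (++⁺ (Unique-++⁻ˡ zpre uqZ)
                     (subst Unique (reverse-++ spre [ x ]) (Unique-reverse (Unique-∷ʳ-prefix spre uqS)))
                     (disjoint back⊆sl))
                (length-++-∷ zpre (reverse spre)))
        where
          spre≤ : length (reverse spre) ≤ d
          spre≤ = subst (_≤ d) (sym (length-reverse spre)) (length-prefix≤ spre spost lenS)

module BlossomProperties {n : ℕ} (G : Graph n) (M : Matching G) (el ol : Fin n → ℕ∞) (lm : ℕ∞)
                         (isEvenlevel : Theory.IsEvenlevel G M el)
                         (isOddlevel : Theory.IsOddlevel G M ol) where
  open Graph G
  open Matching M
  open Theory G M
  open Levels el ol lm
  open AlternatingWalks G M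
  open DecMembership (Fin._≟_ {n}) using (_∈?_)

  evenlevel≤ : ∀ {v ℓ} → Path v false ℓ → el v ≤∞ fin ℓ
  evenlevel≤ {v} {ℓ} p with el v | isEvenlevel v
  ... | fin _ | _ , minimal = fin≤fin (minimal ℓ (Path⇒Even p , Path⇒AltPathTo p))
  ... | ∞     | none       = ⊥-elim (none ℓ (Path⇒Even p , Path⇒AltPathTo p))

  oddlevel≤ : ∀ {v ℓ} → Path v true ℓ → ol v ≤∞ fin ℓ
  oddlevel≤ {v} {ℓ} p with ol v | isOddlevel v
  ... | fin _ | _ , minimal = fin≤fin (minimal ℓ (Path⇒Odd p , Path⇒AltPathTo p))
  ... | ∞     | none       = ⊥-elim (none ℓ (Path⇒Odd p , Path⇒AltPathTo p))

  evenlevel-path : ∀ {v ℓ} → el v ≡ fin ℓ → Path v false ℓ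
  evenlevel-path {v} el≡ with el v | isEvenlevel v
  evenlevel-path {v} {ℓ} refl | fin _ | (even , _ , _ , un , w , uq , len) , _ with AltWalk⇒Walk w
  ... | _ , w′ =
    path un (subst (Walk false _ v _) (trans (Walk-kind w′ len) (Even⇒parity≡false ℓ even)) w′) uq len

  oddlevel-path : ∀ {v ℓ} → ol v ≡ fin ℓ → Path v true ℓ
  oddlevel-path {v} ol≡ with ol v | isOddlevel v
  oddlevel-path {v} {ℓ} refl | fin _ | (odd , _ , _ , un , w , uq , len) , _ with AltWalk⇒Walk w
  ... | _ , w′ =
    path un (subst (Walk false _ v _) (trans (Walk-kind w′ len) (Odd⇒parity≡true ℓ odd)) w′) uq len

  evenlevel-LevelPath : ∀ {v ℓ} → el v ≡ fin ℓ → (p : Path v false ℓ) →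
                        LevelPath (Path.source p) (Path.vertices p) v
  evenlevel-LevelPath el≡ (path un w uq len) = _ , inj₁ el≡ , un , Walk⇒AltWalk w , uq , len

  tenacity-fin : ∀ {v m} → tenacity v ≡ fin m →
                 ∃₂ λ e o → el v ≡ fin e × ol v ≡ fin o × e + o ≡ m
  tenacity-fin {v} = +∞≡fin (el v) (ol v)

  tenacity-odd : ∀ {v m} → tenacity v ≡ fin m → Odd m
  tenacity-odd t≡ with tenacity-fin t≡
  ... | e , o , el≡ , ol≡ , refl =
    Even+Odd⇒Odd e o (Path⇒Even (evenlevel-path el≡)) (Path⇒Odd (oddlevel-path ol≡))

  level-path : ∀ {v m} → tenacity v ≡ fin m → ∃₂ λ s ps → LevelPath s ps v
  level-path t≡ with tenacity-fin t≡
  ... | _ , _ , el≡ , _ , _ = _ , _ , evenlevel-LevelPath el≡ (evenlevel-path el≡)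

  evenlevel≤suc-oddlevel-mate : ∀ {u u′ o} → Mt u u′ → ol u′ ≡ fin o → el u ≤∞ fin (suc o)
  evenlevel≤suc-oddlevel-mate {u} k ol≡ with oddlevel-path ol≡
  ... | path {vertices = ys} un Y uq len with u ∈? ys
  ... | no u∉ys =
    evenlevel≤ (path un (Walk-∷ʳ Y (Mt⊆Adj (Mt-sym k)) (Mt-sym k))
                        (++⁺ uq ([] ∷ []) (λ { (u∈ys , here refl) → u∉ys u∈ys }))
                        (trans (length-∷ʳ ys) (cong suc len)))
  ... | yes u∈ys with ∈-∃++ u∈ys
  ... | ypre , ypost , refl with Walk-split ypre Y
  ... | false , Y₁ , _ =
    ≤∞-trans (evenlevel≤ (path un Y₁ (Unique-∷ʳ-prefix ypre uq) (length-∷ʳ ypre)))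
             (fin≤fin (m≤n⇒m≤1+n (length-prefix≤ ypre ypost len)))
  ... | true , _ , stop _ = ⊥-elim (adj-irrefl (Mt⊆Adj k))
  ... | true , _ , step _ k′ Y₃ with Mt-func k′ k
  ... | refl with closed-Walk-kind Y₃ (Unique-++⁻ʳ [ u ] (Unique-++⁻ʳ ypre uq))
  ... | ()

  oddlevel<evenlevel-mate : ∀ {u u′ e} → Mt u u′ → el u′ ≡ fin e →
                            ∃ λ ℓ → e ≡ suc ℓ × ol u ≤∞ fin ℓ
  oddlevel<evenlevel-mate {u} {u′} {e} k el≡ with evenlevel-path el≡
  ... | path {vertices = es} un E uq len =
    retrace (Walk-reverse E) (Unique-reverse uq) (trans (length-reverse es) len)
    where
      retrace : ∀ {L} → Walk true u′ _ L true → Unique L → length L ≡ suc e →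
                ∃ λ ℓ → e ≡ suc ℓ × ol u ≤∞ fin ℓ
      retrace (stop _) _ _ = ⊥-elim (un u (Mt-sym k))
      retrace (step {ps = rest} _ k′ R) (_ ∷ uqR) lenL with Mt-func k′ (Mt-sym k)
      ... | refl with Walk-length (Walk-reverse R)
      ... | ℓ , lenB =
        ℓ , trans (sym (suc-injective lenL)) (trans (sym (length-reverse rest)) lenB)
          , oddlevel≤ (path un (Walk-reverse R) (Unique-reverse uqR) lenB)

  tenacity≤tenacity-mate : ∀ {u u′ m} → Mt u u′ → tenacity u′ ≡ fin m → tenacity u ≤∞ fin m
  tenacity≤tenacity-mate {u} k t≡ with tenacity-fin t≡
  ... | e , o , el≡ , ol≡ , refl with oddlevel<evenlevel-mate k el≡
  ... | ℓ , refl , ol≤ =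
    subst (λ m → tenacity u ≤∞ fin m) (cong suc (+-comm o ℓ))
          (+∞-mono-≤∞ (evenlevel≤suc-oddlevel-mate k ol≡) ol≤)

  IsBase-on-evenlevel : ∀ {v b ℓ} → IsBase v b → el v ≡ fin ℓ → (p : Path v false ℓ) →
                        ∃₂ λ pre post → Path.vertices p ≡ pre ++ b ∷ post ×
                          tenacity v <∞ tenacity b × All (λ x → tenacity x ≤∞ tenacity v) post
  IsBase-on-evenlevel ib el≡ p = ib _ _ (evenlevel-LevelPath el≡ p)

  no-matched-exit-below : ∀ {u w ps e m} → tenacity w ≡ fin m → tenacity w <∞ tenacity u →
                          All (λ x → tenacity x ≤∞ tenacity w) ps → ¬ Walk true u w (u ∷ ps) e
  no-matched-exit-below t≡ w<u _     (stop _)     = <∞-irrefl w<u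
  no-matched-exit-below t≡ w<u ps≤w (step _ k R)
    with ≤∞fin⇒fin (subst (_ ≤∞_) t≡ (All.lookup ps≤w (∈-first R)))
  ... | m′ , t′≡ , m′≤m =
    <∞⇒≱∞ (subst (_<∞ _) t≡ w<u) (≤∞-trans (tenacity≤tenacity-mate k t′≡) (fin≤fin m′≤m))

  base-outer : ∀ {w u m} → tenacity w ≡ fin m → IsBase w u → Outer u
  base-outer {w} {u} t≡ ib with tenacity-fin t≡
  ... | L , L′ , el≡ , ol≡ , refl with evenlevel-path el≡
  ... | path un W uq len with IsBase-on-evenlevel ib el≡ (path un W uq len)
  ... | pre , post , refl , w<u , post≤w with Walk-split pre W
  ... | true  , _ , S = ⊥-elim (no-matched-exit-below t≡ w<u post≤w S)
  ... | false , R , S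
    with ≤∞fin⇒fin (evenlevel≤ (path un R (Unique-∷ʳ-prefix pre uq) (length-∷ʳ pre)))
  ... | eu , elu≡ , eu≤i with ol u in olu≡
  ... | ∞     = subst (_<∞ ∞) (sym elu≡) fin<∞
  ... | fin a with eu <? a
  ... | yes eu<a = subst (_<∞ fin a) (sym elu≡) (fin<fin eu<a)
  ... | no eu≮a = ⊥-elim (too-short (splice (oddlevel-path ol≡) S (Unique-++⁻ʳ pre uq) refl))
    where
      open ≤-Reasoning
      i d : ℕ
      i = length pre
      d = length post

      L≡i+d : L ≡ i + d
      L≡i+d = suc-injective (trans (sym len) (length-++-∷ pre post))

      w<u′ : fin (L + L′) <∞ fin (eu + a)
      w<u′ = subst₂ _<∞_ (cong₂ _+∞_ el≡ ol≡) (cong (_+∞ fin a) elu≡) w<u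

      L′+d<a : L′ + d < a
      L′+d<a = +-cancelˡ-< i (L′ + d) a (begin-strict
        i + (L′ + d)  ≡⟨ cong (i +_) (+-comm L′ d) ⟩
        i + (d + L′)  ≡⟨ +-assoc i d L′ ⟨
        i + d + L′    ≡⟨ cong (_+ L′) L≡i+d ⟨
        L + L′        <⟨ fin<fin⁻¹ w<u′ ⟩
        eu + a        ≤⟨ +-monoˡ-≤ a eu≤i ⟩
        i + a         ∎)

      too-short : ¬ Shortcut w false u (L′ + d)
      too-short (inj₁ (ℓ , ℓ≤ , P)) = <-irrefl refl (begin-strict
        L       ≤⟨ fin≤fin⁻¹ (subst (_≤∞ _) el≡ (evenlevel≤ P)) ⟩
        ℓ       ≤⟨ ℓ≤ ⟩
        L′ + d  <⟨ L′+d<a ⟩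
        a       ≤⟨ ≮⇒≥ eu≮a ⟩
        eu      ≤⟨ eu≤i ⟩
        i       ≤⟨ m≤m+n i d ⟩
        i + d   ≡⟨ L≡i+d ⟨
        L       ∎)
      too-short (inj₂ (ℓ , ℓ≤ , Q)) = <-irrefl refl (begin-strict
        a       ≤⟨ fin≤fin⁻¹ (subst (_≤∞ _) olu≡ (oddlevel≤ Q)) ⟩
        ℓ       ≤⟨ ℓ≤ ⟩
        L′ + d  <⟨ L′+d<a ⟩
        a       ∎)

  tenacity<base : ∀ {w u m} → tenacity w ≡ fin m → IsBase w u → tenacity w <∞ tenacity u
  tenacity<base t≡ ib with level-path t≡
  ... | s , ps , lp with ib s ps lp
  ... | _ , _ , _ , w<u , _ = w<u

  base-unique : ∀ {v b b′ m} → tenacity v ≡ fin m → IsBase v b → IsBase v b′ → b ≡ b′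
  base-unique t≡ ib ib′ with level-path t≡
  ... | s , ps , lp with ib s ps lp | ib′ s ps lp
  ... | pre , _ , ps≡ , v<b , post≤v | pre′ , _ , ps≡′ , v<b′ , post′≤v
    with ++-∷-trichotomy pre pre′ (trans (sym ps≡) ps≡′)
  ... | inj₁ b≡b′            = b≡b′
  ... | inj₂ (inj₁ b∈post′) = ⊥-elim (<∞⇒≱∞ v<b (All.lookup post′≤v b∈post′))
  ... | inj₂ (inj₂ b′∈post) = ⊥-elim (<∞⇒≱∞ v<b′ (All.lookup post≤v b′∈post))

  BaseIter-functional : ∀ {k v u u′} → BaseIter k v u → BaseIter k v u′ → u ≡ u′
  BaseIter-functional base0 base0 = refl
  BaseIter-functional (baseSuc v→w w<lm ib) (baseSuc v→w′ _ ib′)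
    with BaseIter-functional v→w v→w′
  ... | refl = base-unique (proj₂ (<∞-fin w<lm)) ib ib′

  BaseIter-suc⇒IsBase : ∀ {k v u b} → BaseIter k v u → BaseIter (suc k) v b → IsBase u b
  BaseIter-suc⇒IsBase v→u (baseSuc v→u′ _ ib) with BaseIter-functional v→u′ v→u
  ... | refl = ib

  -- Tenacity 1 forces evenlevel 0, and an evenlevel path of length 0 has no room for a base of higher tenacity.
  base-tenacity≥3 : ∀ {v b m} → IsBase v b → tenacity v ≡ fin m → ∃ λ m′ → m ≡ 2 + m′
  base-tenacity≥3 {m = suc (suc m′)} _ _ = m′ , refl
  base-tenacity≥3 {m = zero} _ t≡ with tenacity-odd t≡
  ... | ()
  base-tenacity≥3 {m = suc zero} ib t≡ with tenacity-fin t≡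
  ... | suc (suc _) , _ , _ , _ , ()
  ... | suc zero , _ , el≡ , _ , _ with Path⇒Even (evenlevel-path el≡)
  ...   | ()
  base-tenacity≥3 {m = suc zero} ib t≡ | zero , _ , el≡ , _ , _ with evenlevel-path el≡
  ... | path _ (step _ _ w) _ len with trans (sym (proj₂ (Walk-length w))) (suc-injective len)
  ...   | ()
  base-tenacity≥3 {m = suc zero} ib t≡ | zero , _ , el≡ , _ , _ | path un (stop _) uq len
    with IsBase-on-evenlevel ib el≡ (path un (stop _) uq len)
  ... | pre , post , ps≡ , v<b , _ with singleton-split pre post ps≡
  ...   | refl = ⊥-elim (<∞-irrefl v<b)

  InBlossom-mono : ∀ {b t₁ w} t₂ → Outer b → Odd t₁ → Odd t₂ → t₁ ≤ t₂ →
                   InBlossom b t₁ w → InBlossom b t₂ w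
  InBlossom-mono (suc zero)    _  () _  z≤n         _
  InBlossom-mono (suc zero)    _  _  _  (s≤s z≤n)   w∈ = w∈
  InBlossom-mono (suc (suc t)) ob o₁ o₂ t₁≤ w∈ with _ ≤? t
  ... | yes t₁≤t = inSub (inj₁ refl) ob (InBlossom-mono t ob o₁ o₂ t₁≤t w∈)
  ... | no t₁≰t with m≤n⇒m<n∨m≡n t₁≤
  ...   | inj₂ refl = w∈
  ...   | inj₁ t₁<  = ⊥-elim (t₁≰t (≤-pred (≤-pred (odd-gap o₁ o₂ t₁<))))

  BaseIter⇒InBlossom : ∀ k {v u b t} → BaseIter k v u → IsBase u b → Odd t →
                       tenacity u ≤∞ fin t → InBlossom b t v
  BaseIter⇒InBlossom zero base0 ib ot tv≤t with ≤∞fin⇒fin tv≤t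
  ... | tv , tv≡ , tv≤t′ with base-tenacity≥3 ib tv≡
  ... | _ , refl = InBlossom-mono _ (base-outer tv≡ ib) (tenacity-odd tv≡) ot tv≤t′ (inS tv≡ ib)
  BaseIter⇒InBlossom (suc k) (baseSuc v→w w<lm ibw) ibu ot tu≤t
    with ≤∞fin⇒fin tu≤t | <∞-fin w<lm
  ... | tu , tu≡ , tu≤t′ | tw , tw≡
    with odd-gap (tenacity-odd tw≡) (tenacity-odd tu≡)
                 (fin<fin⁻¹ (subst₂ _<∞_ tw≡ tu≡ (tenacity<base tw≡ ibw)))
  ... | s≤s (s≤s tw≤tu′) =
    InBlossom-mono _ (base-outer tu≡ ibu) (tenacity-odd tu≡) ot tu≤t′
      (inSub (inj₂ (tu≡ , ibu)) (base-outer tw≡ ibw)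
             (BaseIter⇒InBlossom k v→w ibw (tenacity-odd tu≡)
                                 (subst (_≤∞ _) (sym tw≡) (fin≤fin tw≤tu′))))

lemma9 : ∀ {n} (G : Graph n) (M : Matching G) →
         ∃ (λ v → Theory.Unmatched G M v) →
         (el ol : Fin n → ℕ∞) (lm : ℕ∞) →
         Theory.IsEvenlevel G M el → Theory.IsOddlevel G M ol → Theory.IsLm G M lm →
         ∀ (b : Fin n) (t : ℕ) →
         Theory.Levels.Outer G M el ol lm b → Odd t →
         fin t <∞ Theory.Levels.tenacity G M el ol lm b → fin t <∞ lm →
         ∀ (v : Fin n) (k : ℕ) (u : Fin n) →
         Theory.Levels.BaseIter G M el ol lm k v u →
         Theory.Levels.BaseIter G M el ol lm (suc k) v b →
         Theory.Levels.tenacity G M el ol lm u ≤∞ fin t →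
         Theory.Levels.InBlossom G M el ol lm b t v
-- That b is outer and that t < t(b), t < l_m only make 𝓑_{b,t} a blossom; membership of v does not need them.
lemma9 G M _ el ol lm isEvenlevel isOddlevel _ b t _ odd _ _ v k u v→u v→b tu≤t =
  BaseIter⇒InBlossom k v→u (BaseIter-suc⇒IsBase v→u v→b) odd tu≤t
  where open BlossomProperties G M el ol lm isEvenlevel isOddlevel
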